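{- Every $\varphi$-practical number is weakly $\varphi$-practical.
   Context: $\varphi$ denotes Euler's totient function. A positive integer $n$ is $\varphi$-practical if every integer $m$ with $1\le m\le n$ can be written as $m=\sum_{d\in\mathcal D}\varphi(d)$ for some subset $\mathcal D$ of the positive divisors of $n$. Write $n=p_1^{e_1}\cdots p_k^{e_k}$ with primes $p_1<p_2<\cdots<p_k$ and $e_i\ge 1$, and set $m_i=p_1^{e_1}\cdots p_i^{e_i}$ for $i=0,\dots,k-1$ (so $m_0=1$). The integer $n$ is called weakly $\varphi$-practical if $p_{i+1}\le m_i+2$ for every $i=0,\dots,k-1$. -}

module Defs where

open import Data.Nat using (ℕ; zero; suc; _+_; _*_; _^_; _≤_; _<_)
open import Relation.Binary.PropositionalEquality using (_≡_)
open import Data.Nat.Divisibility using (_∣?_)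
open import Data.Nat.Coprimality using (coprime?)
open import Data.Nat.Primality using (Prime)
open import Data.Nat.ListAction using (sum; product)
open import Data.List using (List; []; _∷_; map; filter; length; upTo)
open import Data.List.Relation.Binary.Sublist.Propositional using (_⊆_)
open import Data.List.Relation.Unary.All using (All)
open import Data.List.Relation.Unary.Linked using (Linked)
open import Data.Product using (_×_; _,_; proj₁; proj₂; ∃)
open import Data.Unit using (⊤)

range1 : ℕ → List ℕ
range1 n = map suc (upTo n)

φ : ℕ → ℕ
φ n = length (filter (λ k → coprime? k n) (range1 n))

divisors : ℕ → List ℕ
divisors n = filter (λ d → d ∣? n) (range1 n)

-- n is φ-practical: n ≥ 1 and every m with 1 ≤ m ≤ n is a sum of φ(d)
-- over a subset D of the divisors of n (subsets = sublists of the
-- duplicate-free list of divisors)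
PhiPractical : ℕ → Set
PhiPractical n = 1 ≤ n × (∀ m → 1 ≤ m → m ≤ n →
  ∃ λ (D : List ℕ) → D ⊆ divisors n × sum (map φ D) ≡ m)

IsFactorization : ℕ → List (ℕ × ℕ) → Set
IsFactorization n fs =
  All (λ pe → Prime (proj₁ pe)) fs
  × All (λ pe → 1 ≤ proj₂ pe) fs
  × Linked _<_ (map proj₁ fs)
  × product (map (λ pe → proj₁ pe ^ proj₂ pe) fs) ≡ n

-- WeakCond m fs: with m = m_i the product of the prime powers already
-- processed, the next prime p_{i+1} satisfies p_{i+1} ≤ m_i + 2, and so on.
WeakCond : ℕ → List (ℕ × ℕ) → Set
WeakCond m [] = ⊤
WeakCond m ((p , e) ∷ fs) = p ≤ m + 2 × WeakCond (m * p ^ e) fs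

-- n weakly φ-practical: for its prime factorization n = p_1^e_1 ⋯ p_k^e_k,
-- p_{i+1} ≤ m_i + 2 for all i = 0..k-1, where m_0 = 1.
-- (Stated for every factorization; it exists and is unique for n ≥ 1.)
WeaklyPhiPractical : ℕ → Set
WeaklyPhiPractical n = ∀ fs → IsFactorization n fs → WeakCond 1 fs

module Submission where

-- Let n = p₁^e₁ ⋯ p_k^e_k be φ-practical and suppose p_{i+1} > m_i + 2 for
-- some i, where m = m_i = p₁^e₁ ⋯ p_i^e_i.  Since m + 1 ≤ n, there is a set D
-- of divisors of n with Σ_{d ∈ D} φ(d) = m + 1.  A divisor d of n that does
-- not divide m has a prime factor q ≥ p_{i+1}, and then φ(d) ≥ q - 1 > m + 1;
-- so every d ∈ D divides m.  But distinct divisors of m have φ-sum at most m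
-- (half of Gauss' identity Σ_{d ∣ m} φ(d) = m), a contradiction.

open import Defs
open import Data.Nat
open import Data.Nat.Properties
open import Data.Nat.Divisibility
open import Data.Nat.GCD
open import Data.Nat.Coprimality using (Coprime; coprime?; coprime-divisor; gcd≡1⇒coprime; coprime⇒gcd≡1)
open import Data.Nat.Primality using (Prime; prime⇒irreducible; prime⇒nonZero; prime⇒nonTrivial)
open import Data.Nat.ListAction using (sum; product)
open import Data.Nat.Solver using (module +-*-Solver)
open import Algebra.Properties.CommutativeSemigroup +-commutativeSemigroup using (interchange)
open import Data.Bool using (true; false; if_then_else_)
open import Data.List using (List; []; _∷_; map; filter; length; upTo; _++_; [_])
open import Data.List.Properties using (upTo-∷ʳ; map-++; filter-++; length-++)
open import Data.List.Relation.Unary.All as All using (All; []; _∷_)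
import Data.List.Relation.Unary.All.Properties as AllP
open import Data.List.Relation.Unary.Unique.Propositional using (Unique)
import Data.List.Relation.Unary.Unique.Propositional.Properties as UniqueP
open import Data.List.Relation.Unary.AllPairs using ([]; _∷_)
open import Data.List.Relation.Unary.Linked using (Linked)
import Data.List.Relation.Unary.Linked as Linked
open import Data.List.Relation.Unary.Linked.Properties using (Linked⇒AllPairs)
open import Data.List.Relation.Binary.Sublist.Propositional using (_⊆_; []; _∷_; _∷ʳ_)
open import Data.List.Relation.Binary.Sublist.Propositional.Properties using (All-resp-⊆)
open import Data.Product using (_×_; _,_; proj₁; proj₂; ∃)
open import Data.Sum using (inj₁; inj₂)
open import Data.Unit using (tt)
open import Data.Empty using (⊥-elim)
open import Relation.Nullary using (yes; no; does; ¬_)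
open import Relation.Unary using (Decidable)
open import Relation.Binary.PropositionalEquality hiding ([_])

indicator : {P : ℕ → Set} → Decidable P → ℕ → ℕ
indicator P? x = if does (P? x) then 1 else 0

count : {P : ℕ → Set} → Decidable P → ℕ → ℕ
count P? zero    = 0
count P? (suc k) = count P? k + indicator P? (suc k)

range1-suc : ∀ k → range1 (suc k) ≡ range1 k ++ [ suc k ]
range1-suc k = trans (cong (map suc) (sym (upTo-∷ʳ k))) (map-++ suc (upTo k) [ k ])

length-filter-range1 : {P : ℕ → Set} (P? : Decidable P) (k : ℕ) →
                       length (filter P? (range1 k)) ≡ count P? k
length-filter-range1 P? zero    = refl
length-filter-range1 P? (suc k) = begin
  length (filter P? (range1 (suc k)))                          ≡⟨ cong (λ l → length (filter P? l)) (range1-suc k) ⟩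
  length (filter P? (range1 k ++ [ suc k ]))                   ≡⟨ cong length (filter-++ P? (range1 k) [ suc k ]) ⟩
  length (filter P? (range1 k) ++ filter P? [ suc k ])         ≡⟨ length-++ (filter P? (range1 k)) ⟩
  length (filter P? (range1 k)) + length (filter P? [ suc k ]) ≡⟨ cong₂ _+_ (length-filter-range1 P? k) singleton ⟩
  count P? k + indicator P? (suc k)                            ∎
  where
  open ≡-Reasoning
  singleton : length (filter P? [ suc k ]) ≡ indicator P? (suc k)
  singleton with does (P? (suc k))
  ... | true  = refl
  ... | false = refl

φ≡count : ∀ d → φ d ≡ count (λ k → coprime? k d) d
φ≡count d = length-filter-range1 (λ k → coprime? k d) d

module _ {P : ℕ → Set} (P? : Decidable P) where

  indicator-yes : ∀ x → P x → indicator P? x ≡ 1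
  indicator-yes x px with P? x
  ... | yes _  = refl
  ... | no ¬px = ⊥-elim (¬px px)

  indicator-no : ∀ x → ¬ P x → indicator P? x ≡ 0
  indicator-no x ¬px with P? x
  ... | yes px = ⊥-elim (¬px px)
  ... | no _   = refl

  count-mono : ∀ {k l} → k ≤ l → count P? k ≤ count P? l
  count-mono {l = zero}  z≤n = z≤n
  count-mono {l = suc l} k≤1+l with m≤n⇒m<n∨m≡n k≤1+l
  ... | inj₂ refl      = ≤-refl
  ... | inj₁ (s≤s k≤l) = ≤-trans (count-mono k≤l) (m≤m+n _ _)

  count-all : ∀ k → (∀ i → 1 ≤ i → i ≤ k → P i) → count P? k ≡ k
  count-all zero    _   = refl
  count-all (suc k) all = begin
    count P? k + indicator P? (suc k) ≡⟨ cong₂ _+_ (count-all k (λ i 1≤i i≤k → all i 1≤i (m≤n⇒m≤1+n i≤k)))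
                                                   (indicator-yes (suc k) (all (suc k) (s≤s z≤n) ≤-refl)) ⟩
    k + 1                             ≡⟨ +-comm k 1 ⟩
    suc k                             ∎
    where open ≡-Reasoning

  AtMostOneFailure : ℕ → Set
  AtMostOneFailure k = ∀ i j → 1 ≤ i → i ≤ k → 1 ≤ j → j ≤ k → ¬ P i → ¬ P j → i ≡ j

  -- Then P holds on at least k - 1 elements of [1, k]: if it fails at k + 1,
  -- it holds on all of [1, k].

  count-one-failure : ∀ k → AtMostOneFailure k → k ≤ suc (count P? k)
  count-one-failure zero    _   = z≤n
  count-one-failure (suc k) one with P? (suc k)
  ... | yes _  = ≤-trans (s≤s (count-one-failure k restrict)) (≤-reflexive (cong suc (+-comm 1 (count P? k))))
    where
    restrict : AtMostOneFailure k
    restrict i j 1≤i i≤k 1≤j j≤k = one i j 1≤i (m≤n⇒m≤1+n i≤k) 1≤j (m≤n⇒m≤1+n j≤k)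
  ... | no ¬Pk = ≤-reflexive (cong suc (sym (trans (cong (_+ 0) (count-all k below)) (+-identityʳ k))))
    where
    below : ∀ i → 1 ≤ i → i ≤ k → P i
    below i 1≤i i≤k with P? i
    ... | yes Pi  = Pi
    ... | no ¬Pi = ⊥-elim (<⇒≢ (s≤s i≤k) (one i (suc k) 1≤i (m≤n⇒m≤1+n i≤k) (s≤s z≤n) ≤-refl ¬Pi ¬Pk))

count-mono-pred : {P Q : ℕ → Set} (P? : Decidable P) (Q? : Decidable Q) →
                  (∀ x → P x → Q x) → ∀ k → count P? k ≤ count Q? k
count-mono-pred P? Q? P⇒Q zero    = z≤n
count-mono-pred P? Q? P⇒Q (suc k) = +-mono-≤ (count-mono-pred P? Q? P⇒Q k) indicator-mono
  where
  indicator-mono : indicator P? (suc k) ≤ indicator Q? (suc k)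
  indicator-mono with P? (suc k) | Q? (suc k)
  ... | yes _  | yes _  = ≤-refl
  ... | yes Pk | no ¬Qk = ⊥-elim (¬Qk (P⇒Q (suc k) Pk))
  ... | no _   | _      = z≤n

count-stretch : {R : ℕ → Set} (R? : Decidable R) (f : ℕ → ℕ) →
                (∀ j → f j < f (suc j)) → ∀ d → count (λ j → R? (f j)) d ≤ count R? (f d)
count-stretch R? f f-inc zero    = z≤n
count-stretch R? f f-inc (suc d) = step (f (suc d)) (f-inc d)
  where
  step : ∀ y → f d < y → count (λ j → R? (f j)) d + indicator R? y ≤ count R? y
  step (suc x) (s≤s fd≤x) =
    +-monoˡ-≤ (indicator R? (suc x)) (≤-trans (count-stretch R? f f-inc d) (count-mono R? fd≤x))

sum-map-+ : {A : Set} (f g : A → ℕ) (xs : List A) →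
            sum (map (λ a → f a + g a) xs) ≡ sum (map f xs) + sum (map g xs)
sum-map-+ f g []       = refl
sum-map-+ f g (x ∷ xs) =
  trans (cong (f x + g x +_) (sum-map-+ f g xs)) (interchange (f x) (g x) (sum (map f xs)) (sum (map g xs)))

sum-map-mono : {A : Set} (f g : A → ℕ) (xs : List A) →
               All (λ x → f x ≤ g x) xs → sum (map f xs) ≤ sum (map g xs)
sum-map-mono f g []       []           = z≤n
sum-map-mono f g (x ∷ xs) (fx≤gx ∷ le) = +-mono-≤ fx≤gx (sum-map-mono f g xs le)

module _ {Q : ℕ → ℕ → Set} (Q? : ∀ d → Decidable (Q d))
         (functional : ∀ {d d' x} → Q d x → Q d' x → d ≡ d') where

  private
    indicators-0 : ∀ x ds → All (λ d → ¬ Q d x) ds → sum (map (λ d → indicator (Q? d) x) ds) ≡ 0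
    indicators-0 x []       []          = refl
    indicators-0 x (d ∷ ds) (¬Q ∷ ¬Qs) = cong₂ _+_ (indicator-no (Q? d) x ¬Q) (indicators-0 x ds ¬Qs)

    indicators-≤1 : ∀ x ds → Unique ds → sum (map (λ d → indicator (Q? d) x) ds) ≤ 1
    indicators-≤1 x []       _          = z≤n
    indicators-≤1 x (d ∷ ds) (d∉ds ∷ u) with Q? d x
    ... | yes Qdx = ≤-reflexive (cong suc (indicators-0 x ds (All.map (λ d≢d' Qd'x → d≢d' (functional Qdx Qd'x)) d∉ds)))
    ... | no _    = indicators-≤1 x ds u

  count-disjoint : ∀ K ds → Unique ds → sum (map (λ d → count (Q? d) K) ds) ≤ K
  count-disjoint zero    []       _ = z≤n
  count-disjoint zero    (_ ∷ ds) (_ ∷ u) = count-disjoint zero ds u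
  count-disjoint (suc K) ds u = begin
    sum (map (λ d → count (Q? d) K + indicator (Q? d) (suc K)) ds)
      ≡⟨ sum-map-+ (λ d → count (Q? d) K) (λ d → indicator (Q? d) (suc K)) ds ⟩
    sum (map (λ d → count (Q? d) K) ds) + sum (map (λ d → indicator (Q? d) (suc K)) ds)
      ≤⟨ +-mono-≤ (count-disjoint K ds u) (indicators-≤1 (suc K) ds u) ⟩
    K + 1
      ≡⟨ +-comm K 1 ⟩
    suc K ∎
    where open ≤-Reasoning

coprime-1+ts : ∀ t s {c} → c ∣ suc (t * s) → c ∣ s → c ≡ 1
coprime-1+ts t s {c} c∣1+ts c∣s =
  ∣1⇒≡1 (∣m+n∣m⇒∣n (subst (c ∣_) (+-comm 1 (t * s)) c∣1+ts) (∣n⇒∣m*n t c∣s))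

-- For d = s·q with q prime, the q numbers 1, 1 + s, …, 1 + (q-1)s lie in
-- [1, d]; each is coprime to s, so it fails to be coprime to d only if q
-- divides it, which happens for at most one of them.  Hence φ(d) ≥ q - 1.
module _ {q s' : ℕ} (q-prime : Prime q) where
  private
    s = suc s'
    d = s * q

    progression : ℕ → ℕ
    progression zero    = 0
    progression (suc j) = suc (j * s)

    progression-inc : ∀ j → progression j < progression (suc j)
    progression-inc zero    = s≤s z≤n
    progression-inc (suc j) = s≤s (m<n+m (j * s) (s≤s z≤n))

    progression-≤ : ∀ r → progression r ≤ s * r
    progression-≤ zero     = z≤n
    progression-≤ (suc r) = begin
      suc (r * s)   ≡⟨ cong suc (*-comm r s) ⟩
      suc (s * r)   ≤⟨ s≤s (m≤n+m (s * r) s') ⟩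
      s + s * r     ≡⟨ sym (*-suc s r) ⟩
      s * suc r     ∎
      where open ≤-Reasoning

    -- gcd(1 + t·s, d) divides q (it is coprime to s), so it is 1 or q.
    non-coprime⇒q∣ : ∀ t → ¬ Coprime (suc (t * s)) d → q ∣ suc (t * s)
    non-coprime⇒q∣ t ¬cop with prime⇒irreducible q-prime g∣q
      where
      g = gcd (suc (t * s)) d
      g∣q : g ∣ q
      g∣q = coprime-divisor (λ (c∣g , c∣s) → coprime-1+ts t s (∣-trans c∣g (gcd[m,n]∣m _ d)) c∣s)
                            (gcd[m,n]∣n (suc (t * s)) d)
    ... | inj₁ g≡1 = ⊥-elim (¬cop (gcd≡1⇒coprime g≡1))
    ... | inj₂ g≡q = subst (_∣ suc (t * s)) g≡q (gcd[m,n]∣m (suc (t * s)) d)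

    -- If q ∣ 1 + i·s and q ∣ 1 + j·s with i ≤ j < q, then q ∣ (j - i)·s and
    -- q ∤ s, so q ∣ j - i < q, i.e. i = j.
    at-most-one-multiple : ∀ i j → i ≤ j → j < q → q ∣ suc (i * s) → q ∣ suc (j * s) → i ≡ j
    at-most-one-multiple i j i≤j j<q q∣i q∣j = trans (sym (+-identityʳ i)) (trans (cong (i +_) (sym u≡0)) (m+[n∸m]≡n i≤j))
      where
      open +-*-Solver
      u = j ∸ i
      j-as-i : suc (j * s) ≡ u * s + suc (i * s)
      j-as-i = trans (cong (λ z → suc (z * s)) (sym (m+[n∸m]≡n i≤j)))
                     (solve 3 (λ i u s → con 1 :+ (i :+ u) :* s := u :* s :+ (con 1 :+ i :* s)) refl i u s)
      q∣us : q ∣ u * s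
      q∣us = ∣m+n∣m⇒∣n (subst (q ∣_) (trans j-as-i (+-comm (u * s) _)) q∣j) q∣i
      q∣u : q ∣ u
      q∣u = coprime-divisor (λ (c∣q , c∣s) → coprime-1+ts i s (∣-trans c∣q q∣i) c∣s) (subst (q ∣_) (*-comm u s) q∣us)
      u≡0 : u ≡ 0
      u≡0 with u | q∣u | ≤-<-trans (m∸n≤m j i) j<q
      ... | zero  | _   | _   = refl
      ... | suc _ | q∣u | u<q = ⊥-elim (<⇒≱ u<q (∣⇒≤ q∣u))

    one-failure : AtMostOneFailure (λ j → coprime? (progression j) d) q
    one-failure (suc i) (suc j) _ i<q _ j<q ¬ci ¬cj with ≤-total i j
    ... | inj₁ i≤j = cong suc (at-most-one-multiple i j i≤j j<q (non-coprime⇒q∣ i ¬ci) (non-coprime⇒q∣ j ¬cj))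
    ... | inj₂ j≤i = cong suc (sym (at-most-one-multiple j i j≤i i<q (non-coprime⇒q∣ j ¬cj) (non-coprime⇒q∣ i ¬ci)))

  q≤1+φ[sq] : q ≤ suc (φ d)
  q≤1+φ[sq] = begin
    q                                                     ≤⟨ count-one-failure (λ j → coprime? (progression j) d) q one-failure ⟩
    suc (count (λ j → coprime? (progression j) d) q)      ≤⟨ s≤s (count-stretch (λ k → coprime? k d) progression progression-inc q) ⟩
    suc (count (λ k → coprime? k d) (progression q))     ≤⟨ s≤s (count-mono (λ k → coprime? k d) (progression-≤ q)) ⟩
    suc (count (λ k → coprime? k d) d)                    ≡⟨ cong suc (sym (φ≡count d)) ⟩
    suc (φ d)                                             ∎
    where open ≤-Reasoning

prime∣⇒≤1+φ : ∀ {q d} → Prime q → q ∣ d → 1 ≤ d → q ≤ suc (φ d)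
prime∣⇒≤1+φ q-prime (divides zero    d≡0) 1≤d = ⊥-elim (<⇒≢ 1≤d (sym d≡0))
prime∣⇒≤1+φ q-prime (divides (suc s') refl) _ = q≤1+φ[sq] {s' = s'} q-prime

-- Classify
-- k ∈ [1, M] by the divisor M / gcd(k, M); the class of d contains c·j for
-- every j ∈ [1, d] coprime to d (where M = c·d), so it has at least φ(d)
-- elements, and distinct d give disjoint classes.
module _ (M : ℕ) (1≤M : 1 ≤ M) where
  private
    Class : ℕ → ℕ → Set
    Class d k = d * gcd k M ≡ M

    Class? : ∀ d → Decidable (Class d)
    Class? d k = d * gcd k M ≟ M

    Class-functional : ∀ {d d' k} → Class d k → Class d' k → d ≡ d'
    Class-functional {d} {d'} {k} e e' with gcd k M
    ... | zero  = ⊥-elim (<⇒≢ 1≤M (trans (sym (*-zeroʳ d)) e))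
    ... | suc g = *-cancelʳ-≡ d d' (suc g) (trans e (sym e'))

    φ≤count-Class : ∀ d → d ∣ M → φ d ≤ count (Class? d) M
    φ≤count-Class d (divides zero M≡0) = ⊥-elim (<⇒≢ 1≤M (sym M≡0))
    φ≤count-Class d (divides c@(suc _) M≡cd) = begin
      φ d                                      ≡⟨ φ≡count d ⟩
      count (λ j → coprime? j d) d             ≤⟨ count-mono-pred (λ j → coprime? j d) (λ j → Class? d (c * j)) coprime⇒Class d ⟩
      count (λ j → Class? d (c * j)) d         ≤⟨ count-stretch (Class? d) (c *_) (λ j → *-monoʳ-< c (n<1+n j)) d ⟩
      count (Class? d) (c * d)                 ≡⟨ cong (count (Class? d)) (sym M≡cd) ⟩
      count (Class? d) M                       ∎
      where
      open ≤-Reasoning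
      coprime⇒Class : ∀ j → Coprime j d → Class d (c * j)
      coprime⇒Class j cop = begin-equality
        d * gcd (c * j) M        ≡⟨ cong (λ z → d * gcd (c * j) z) M≡cd ⟩
        d * gcd (c * j) (c * d)  ≡⟨ cong (d *_) (sym (c*gcd[m,n]≡gcd[cm,cn] c j d)) ⟩
        d * (c * gcd j d)        ≡⟨ cong (λ z → d * (c * z)) (coprime⇒gcd≡1 cop) ⟩
        d * (c * 1)              ≡⟨ cong (d *_) (*-identityʳ c) ⟩
        d * c                    ≡⟨ *-comm d c ⟩
        c * d                    ≡⟨ sym M≡cd ⟩
        M                        ∎

  Σφ-divisors≤ : ∀ ds → Unique ds → All (_∣ M) ds → sum (map φ ds) ≤ M
  Σφ-divisors≤ ds unique divide = begin
    sum (map φ ds)                              ≤⟨ sum-map-mono φ (λ d → count (Class? d) M) ds (All.map (φ≤count-Class _) divide) ⟩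
    sum (map (λ d → count (Class? d) M) ds)     ≤⟨ count-disjoint Class? (λ {d} {d'} {k} → Class-functional {d} {d'} {k}) M ds unique ⟩
    M                                           ∎
    where open ≤-Reasoning

prime-powers : List (ℕ × ℕ) → ℕ
prime-powers fs = product (map (λ pe → proj₁ pe ^ proj₂ pe) fs)

PrimesFrom : ℕ → List (ℕ × ℕ) → Set
PrimesFrom p = All (λ pe → Prime (proj₁ pe) × p ≤ proj₁ pe)

coprime-∣-pow* : ∀ {d q} → Coprime d q → ∀ e Y → d ∣ q ^ e * Y → d ∣ Y
coprime-∣-pow* {d} cop zero    Y d∣Y = subst (d ∣_) (*-identityˡ Y) d∣Y
coprime-∣-pow* {d} {q} cop (suc e) Y d∣qqY =
  coprime-∣-pow* cop e Y (coprime-divisor cop (subst (d ∣_) (*-assoc q (q ^ e) Y) d∣qqY))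

prime∤⇒coprime : ∀ {d q} → Prime q → ¬ q ∣ d → Coprime d q
prime∤⇒coprime q-prime q∤d (c∣d , c∣q) with prime⇒irreducible q-prime c∣q
... | inj₁ c≡1 = c≡1
... | inj₂ refl = ⊥-elim (q∤d c∣d)

escaping-prime : ∀ p fs m d → PrimesFrom p fs → d ∣ m * prime-powers fs → ¬ d ∣ m →
                 ∃ λ q → Prime q × q ∣ d × p ≤ q
escaping-prime p []              m d _ d∣m* d∤m = ⊥-elim (d∤m (subst (d ∣_) (*-identityʳ m) d∣m*))
escaping-prime p ((q , e) ∷ fs) m d ((q-prime , p≤q) ∷ primes) d∣m* d∤m with q ∣? d
... | yes q∣d = q , q-prime , q∣d , p≤q
... | no  q∤d = escaping-prime p fs m d primes
                  (coprime-∣-pow* (prime∤⇒coprime q-prime q∤d) e (m * R) (subst (d ∣_) reorder d∣m*)) d∤m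
  where
  R = prime-powers fs
  reorder : m * (q ^ e * R) ≡ q ^ e * (m * R)
  reorder = trans (sym (*-assoc m (q ^ e) R)) (trans (cong (_* R) (*-comm m (q ^ e))) (*-assoc (q ^ e) m R))

m<m*[p^e*R] : ∀ m p e R → 1 ≤ m → Prime p → 1 ≤ e → 1 ≤ R → m < m * (p ^ e * R)
m<m*[p^e*R] m p e R 1≤m p-prime 1≤e 1≤R = m<m*n m (p ^ e * R) {{>-nonZero 1≤m}} (begin-strict
  1          <⟨ nonTrivial⇒n>1 p {{prime⇒nonTrivial p-prime}} ⟩
  p          ≡⟨ sym (*-identityʳ p) ⟩
  p ^ 1      ≤⟨ ^-monoʳ-≤ p {{prime⇒nonZero p-prime}} 1≤e ⟩
  p ^ e      ≤⟨ m≤m*n (p ^ e) R {{>-nonZero 1≤R}} ⟩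
  p ^ e * R  ∎)
  where open ≤-Reasoning

divisors-unique : ∀ n → Unique (divisors n)
divisors-unique n = UniqueP.filter⁺ (_∣? n) (UniqueP.map⁺ suc-injective (UniqueP.upTo⁺ n))

Unique-resp-⊆ : ∀ {xs ys : List ℕ} → xs ⊆ ys → Unique ys → Unique xs
Unique-resp-⊆ []           u          = u
Unique-resp-⊆ (y ∷ʳ xs⊆ys) (_ ∷ u)    = Unique-resp-⊆ xs⊆ys u
Unique-resp-⊆ (refl ∷ xs⊆ys) (y∉ ∷ u) = All-resp-⊆ xs⊆ys y∉ ∷ Unique-resp-⊆ xs⊆ys u

φ≤Σφ : ∀ D → All (λ d → φ d ≤ sum (map φ D)) D
φ≤Σφ []      = []
φ≤Σφ (d ∷ D) = m≤m+n (φ d) _ ∷ All.map (λ le → ≤-trans le (m≤n+m _ (φ d))) (φ≤Σφ D)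

module _ (n : ℕ) (practical : PhiPractical n) where
  private
    1≤n : 1 ≤ n
    1≤n = proj₁ practical

    divisor-positive : ∀ {d} → d ∣ n → 1 ≤ d
    divisor-positive {zero}  0∣n = ⊥-elim (<⇒≢ 1≤n (sym (0∣⇒≡0 0∣n)))
    divisor-positive {suc d} _   = s≤s z≤n

    factor-positive : ∀ a b → a * b ≡ n → 1 ≤ b
    factor-positive a b ab≡n = >-nonZero⁻¹ b {{m*n≢0⇒n≢0 a {{subst NonZero (sym ab≡n) (>-nonZero 1≤n)}}}}

  -- Core of the argument: if n = m · p^e · R with every prime of R at least p,
  -- then p ≤ m + 2.  Otherwise write m + 1 as Σ_{d ∈ D} φ(d) over divisors of
  -- n; each d ∈ D has φ(d) ≤ m + 1 < p - 1, so it has no prime factor ≥ p and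
  -- divides m, and the Gauss bound gives m + 1 ≤ m.
  next-prime-bound : ∀ m p e fs → 1 ≤ m → Prime p → 1 ≤ e → PrimesFrom p fs →
                     m * (p ^ e * prime-powers fs) ≡ n → p ≤ m + 2
  next-prime-bound m p e fs 1≤m p-prime 1≤e primes m*≡n with p ≤? m + 2
  ... | yes p≤m+2 = p≤m+2
  ... | no  p≰m+2 = ⊥-elim (<-irrefl refl (begin-strict
    m               <⟨ n<1+n m ⟩
    suc m           ≡⟨ sym ΣφD≡1+m ⟩
    sum (map φ D)   ≤⟨ Σφ-divisors≤ m 1≤m D (Unique-resp-⊆ D⊆divisors (divisors-unique n)) D∣m ⟩
    m               ∎))
    where
    open ≤-Reasoning
    1+m≤n : suc m ≤ n
    1+m≤n = subst (suc m ≤_) m*≡n (m<m*[p^e*R] m p e _ 1≤m p-prime 1≤e (factor-positive (m * p ^ e) _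
              (trans (*-assoc m (p ^ e) _) m*≡n)))
    representation = proj₂ practical (suc m) (s≤s z≤n) 1+m≤n
    D = proj₁ representation
    D⊆divisors = proj₁ (proj₂ representation)
    ΣφD≡1+m = proj₂ (proj₂ representation)

    small-divisor∣m : ∀ d → d ∣ n → φ d ≤ suc m → d ∣ m
    small-divisor∣m d d∣n φd≤1+m with d ∣? m
    ... | yes d∣m = d∣m
    ... | no  d∤m with escaping-prime p ((p , e) ∷ fs) m d ((p-prime , ≤-refl) ∷ primes) (subst (d ∣_) (sym m*≡n) d∣n) d∤m
    ... | q , q-prime , q∣d , p≤q = ⊥-elim (p≰m+2 (begin
      p             ≤⟨ p≤q ⟩
      q             ≤⟨ prime∣⇒≤1+φ q-prime q∣d (divisor-positive d∣n) ⟩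
      suc (φ d)     ≤⟨ s≤s φd≤1+m ⟩
      suc (suc m)   ≡⟨ +-comm 2 m ⟩
      m + 2         ∎))

    D∣m : All (_∣ m) D
    D∣m = All.zipWith (λ { {d} (d∣n , φd≤ΣφD) → small-divisor∣m d d∣n (subst (φ d ≤_) ΣφD≡1+m φd≤ΣφD) })
                      (All-resp-⊆ D⊆divisors (AllP.all-filter (_∣? n) (range1 n)) , φ≤Σφ D)

  weak-condition : ∀ fs m → 1 ≤ m → All (λ pe → Prime (proj₁ pe)) fs → All (λ pe → 1 ≤ proj₂ pe) fs →
                   Linked _<_ (map proj₁ fs) → m * prime-powers fs ≡ n → WeakCond m fs
  weak-condition []              m _   _                  _            _      _    = tt
  weak-condition ((p , e) ∷ fs) m 1≤m (p-prime ∷ primes) (1≤e ∷ exps) sorted m*≡n =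
    next-prime-bound m p e fs 1≤m p-prime 1≤e later-primes m*≡n ,
    weak-condition fs (m * p ^ e) (*-mono-≤ 1≤m (m^n>0 p {{prime⇒nonZero p-prime}} e)) primes exps
                   (Linked.tail sorted) (trans (*-assoc m (p ^ e) (prime-powers fs)) m*≡n)
    where
    later-primes : PrimesFrom p fs
    later-primes with Linked⇒AllPairs <-trans sorted
    ... | p<later ∷ _ = All.zipWith (λ (q-prime , p<q) → q-prime , <⇒≤ p<q) (primes , AllP.map⁻ p<later)

lemma3p3 : (n : ℕ) → PhiPractical n → WeaklyPhiPractical n
lemma3p3 n practical fs (primes , exps , sorted , product≡n) =
  weak-condition n practical fs 1 (s≤s z≤n) primes exps sorted (trans (*-identityˡ _) product≡n)
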